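{- Let $q=2^m$ where $m\ge 3$, and let $B=\{u\in\mathrm{GF}(q):\mathrm{Tr}(u^3)=1\}$. Then the $\mathrm{GF}(2)$-linear span of $B$ is all of $\mathrm{GF}(q)$.
   Context: $\mathrm{Tr}$ denotes the absolute trace from $\mathrm{GF}(2^m)$ to $\mathrm{GF}(2)$. -}

module Defs where

open import Level using (0ℓ; suc)
open import Data.Nat using (ℕ; zero; suc; _^_)
open import Data.Fin using (Fin)
open import Data.List using (List; []; _∷_)
open import Data.Product using (∃)
open import Relation.Nullary using (¬_)
open import Algebra.Bundles using (CommutativeRing)
open import Function.Bundles using (Bijection)
import Relation.Binary.PropositionalEquality as ≡

record GF (m : ℕ) : Set₁ where
  field
    commRing : CommutativeRing 0ℓ 0ℓ
  open CommutativeRing commRing public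
  field
    1≉0     : ¬ (1# ≈ 0#)
    inverse : ∀ x → ¬ (x ≈ 0#) → ∃ λ y → x * y ≈ 1#
    card    : Bijection setoid (≡.setoid (Fin (2 ^ m)))

  pow : Carrier → ℕ → Carrier
  pow x zero    = 1#
  pow x (suc n) = x * pow x n

  trSum : ℕ → Carrier → Carrier
  trSum zero    x = 0#
  trSum (suc k) x = pow x (2 ^ k) + trSum k x

  -- absolute trace GF(2^m) → GF(2) (values 0# or 1# in the field)
  Tr : Carrier → Carrier
  Tr x = trSum m x

  sumL : List Carrier → Carrier
  sumL []       = 0#
  sumL (u ∷ us) = u + sumL us

-- If Q(x) = 1 then x ∈ B.  Otherwise it suffices to find a "partner"
-- y ∈ B with x + y ∈ B, since x = y + (x + y) in characteristic 2.  The
-- cubic form polarizes as Q(x + y) = Q(x) + Q(y) + C(x, y), where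
-- C(x, y) = Tr(x²y) + Tr(xy²) is additive in y.
--   * m odd:  Tr(1) = 1, and y = 1 is a partner since C(x, 1) = 0.
--   * m even: q ≡ 1 (mod 3), so F has a cube root of unity ω ≠ 1.  Take
--     any y₀ ∈ B (a polynomial root count shows B ≠ ∅ when m ≥ 3); then
--     y₀, ωy₀, ω²y₀ ∈ B sum to 0, so the three values Q(x + ωⁱy₀) sum to
--     1 and one of them is 1.
-- The file develops, in order: three arithmetic facts (parity, 4^j ≡ 1
-- mod 3, a degree bound); polynomials and the root bound over a
-- commutative ring; finite fields (Fermat's little theorem, non-roots of
-- polynomials with at most q coefficients); characteristic two and the
-- trace; the form Q, the two partner constructions, the cube root of
-- unity and the nonemptiness of B; finally the theorem.
module Submission where

open import Defs
open import Level using (_⊔_)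
open import Data.Nat as ℕ using (ℕ; zero; suc; _≤_; _<_; z≤n; s≤s)
import Data.Nat.Properties as ℕP
open import Data.Nat.Tactic.RingSolver using (solve-∀)
open import Data.Fin using (Fin; punchIn)
import Data.Fin.Properties as FinP
open import Data.Fin.Permutation using (Permutation; permutation)
open import Data.Product as Product using (∃; _×_; _,_)
open import Data.Sum using (_⊎_; inj₁; inj₂)
open import Data.Empty using (⊥-elim)
open import Data.List using (List; []; _∷_; length; tabulate)
import Data.List.Properties as ListP
open import Data.List.Relation.Unary.All as All using (All; []; _∷_)
import Data.List.Relation.Unary.All.Properties as AllP
open import Data.List.Relation.Unary.AllPairs using (AllPairs; []; _∷_)
import Data.List.Relation.Unary.AllPairs.Properties as AllPairsP
open import Relation.Nullary using (¬_; Dec; yes; no)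
open import Relation.Binary.PropositionalEquality as ≡ using (_≡_; _≢_)
open import Function using (_∘_; id)
open import Function.Bundles using (Bijection)
open import Algebra.Bundles using (CommutativeRing)

even-or-odd : ∀ n → (∃ λ j → n ≡ j ℕ.+ j) ⊎ (∃ λ j → n ≡ suc (j ℕ.+ j))
even-or-odd zero    = inj₁ (0 , ≡.refl)
even-or-odd (suc n) with even-or-odd n
... | inj₁ (j , n≡j+j)   = inj₂ (j , ≡.cong suc n≡j+j)
... | inj₂ (j , n≡1+j+j) = inj₁ (suc j , ≡.cong suc (≡.trans n≡1+j+j (≡.sym (ℕP.+-suc j j))))

four-power : ∀ j → ∃ λ d → 2 ℕ.^ (suc j ℕ.+ suc j) ≡ suc (3 ℕ.* suc d)
four-power zero    = 0 , ≡.refl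
four-power (suc j) with four-power j
... | d , 4ʲ⁺¹≡1+3D = 4 ℕ.* suc d , (begin
  2 ℕ.^ (suc (suc j) ℕ.+ suc (suc j))   ≡⟨ ≡.cong (λ n → 2 ℕ.^ suc n) (ℕP.+-suc (suc j) (suc j)) ⟩
  2 ℕ.* (2 ℕ.* 2 ℕ.^ (suc j ℕ.+ suc j))  ≡⟨ ≡.cong (λ n → 2 ℕ.* (2 ℕ.* n)) 4ʲ⁺¹≡1+3D ⟩
  2 ℕ.* (2 ℕ.* suc (3 ℕ.* suc d))        ≡⟨ times-four d ⟩
  suc (3 ℕ.* suc (4 ℕ.* suc d))          ∎)
  where
  open ≡.≡-Reasoning
  times-four : ∀ d → 2 ℕ.* (2 ℕ.* suc (3 ℕ.* suc d)) ≡ suc (3 ℕ.* suc (4 ℕ.* suc d))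
  times-four = solve-∀

-- the monomials X^(3·2^i), i < k, have degree below 2^(k+1) = 2^k + 2^k
monomial-fits : ∀ {i k} → i < k → suc (3 ℕ.* 2 ℕ.^ i) ≤ 2 ℕ.^ suc k
monomial-fits {i} {k} i<k = begin
  suc (3 ℕ.* 2 ℕ.^ i)              ≡⟨ split (2 ℕ.^ i) ⟩
  2 ℕ.^ suc i ℕ.+ suc (2 ℕ.^ i)    ≤⟨ ℕP.+-mono-≤ (ℕP.^-monoʳ-≤ 2 i<k) (ℕP.^-monoʳ-< 2 (s≤s (s≤s z≤n)) i<k) ⟩
  2 ℕ.^ k ℕ.+ 2 ℕ.^ k              ≡⟨ double (2 ℕ.^ k) ⟨
  2 ℕ.^ suc k                      ∎
  where
  open ℕP.≤-Reasoning
  split : ∀ t → suc (3 ℕ.* t) ≡ 2 ℕ.* t ℕ.+ suc t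
  split = solve-∀
  double : ∀ t → 2 ℕ.* t ≡ t ℕ.+ t
  double = solve-∀

-- Polynomials over a commutative ring, as coefficient lists with the
-- constant term first.
module Polynomials {r ℓ} (R : CommutativeRing r ℓ) where
  open CommutativeRing R hiding (zero)
  open import Algebra.Properties.CommutativeSemiring.Exp commutativeSemiring using (_^_)
  open import Algebra.Properties.Ring ring using (x∙y⁻¹≈ε⇒x≈y)
  open import Relation.Binary.Reasoning.Setoid setoid
  open import Algebra.Solver.Ring.NaturalCoefficients.Default commutativeSemiring
    using (solve; _:=_; _:+_; _:*_)

  Poly : Set r
  Poly = List Carrier

  eval : Poly → Carrier → Carrier
  eval []       x = 0#
  eval (c ∷ cs) x = c + x * eval cs x

  coeff : Poly → ℕ → Carrier
  coeff []       _       = 0#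
  coeff (c ∷ cs) zero    = c
  coeff (c ∷ cs) (suc i) = coeff cs i

  AllZero : Poly → Set (r ⊔ ℓ)
  AllZero = All (_≈ 0#)

  coeff-AllZero : ∀ p i → AllZero p → coeff p i ≈ 0#
  coeff-AllZero []       i       _          = refl
  coeff-AllZero (c ∷ cs) zero    (c≈0 ∷ _)  = c≈0
  coeff-AllZero (c ∷ cs) (suc i) (_ ∷ cs≈0) = coeff-AllZero cs i cs≈0

  infixl 6 _⊕_
  _⊕_ : Poly → Poly → Poly
  []       ⊕ ds       = ds
  (c ∷ cs) ⊕ []       = c ∷ cs
  (c ∷ cs) ⊕ (d ∷ ds) = (c + d) ∷ (cs ⊕ ds)

  eval-⊕ : ∀ p p′ x → eval (p ⊕ p′) x ≈ eval p x + eval p′ x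
  eval-⊕ []       p′       x = sym (+-identityˡ _)
  eval-⊕ (c ∷ cs) []       x = sym (+-identityʳ _)
  eval-⊕ (c ∷ cs) (d ∷ ds) x = begin
    (c + d) + x * eval (cs ⊕ ds) x            ≈⟨ +-congˡ (*-congˡ (eval-⊕ cs ds x)) ⟩
    (c + d) + x * (eval cs x + eval ds x)     ≈⟨ solve 5 (λ c d x u v → (c :+ d) :+ x :* (u :+ v)
                                                          := (c :+ x :* u) :+ (d :+ x :* v))
                                                   refl c d x (eval cs x) (eval ds x) ⟩
    (c + x * eval cs x) + (d + x * eval ds x) ∎

  coeff-⊕ : ∀ p p′ i → coeff (p ⊕ p′) i ≈ coeff p i + coeff p′ i
  coeff-⊕ []       p′       i       = sym (+-identityˡ _)
  coeff-⊕ (c ∷ cs) []       zero    = sym (+-identityʳ _)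
  coeff-⊕ (c ∷ cs) []       (suc i) = sym (+-identityʳ _)
  coeff-⊕ (c ∷ cs) (d ∷ ds) zero    = refl
  coeff-⊕ (c ∷ cs) (d ∷ ds) (suc i) = coeff-⊕ cs ds i

  length-⊕ : ∀ p p′ {n} → length p ≤ n → length p′ ≤ n → length (p ⊕ p′) ≤ n
  length-⊕ []       p′       _         len′      = len′
  length-⊕ (c ∷ cs) []       len       _         = len
  length-⊕ (c ∷ cs) (d ∷ ds) (s≤s len) (s≤s len′) = s≤s (length-⊕ cs ds len len′)

  X^_ : ℕ → Poly
  X^ zero    = 1# ∷ []
  X^ (suc e) = 0# ∷ X^ e

  eval-X^ : ∀ e x → eval (X^ e) x ≈ x ^ e
  eval-X^ zero    x = trans (+-congˡ (zeroʳ x)) (+-identityʳ 1#)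
  eval-X^ (suc e) x = trans (+-identityˡ _) (*-congˡ (eval-X^ e x))

  coeff-X^-same : ∀ e → coeff (X^ e) e ≈ 1#
  coeff-X^-same zero    = refl
  coeff-X^-same (suc e) = coeff-X^-same e

  coeff-X^-other : ∀ e i → i ≢ e → coeff (X^ e) i ≈ 0#
  coeff-X^-other zero    zero    i≢e = ⊥-elim (i≢e ≡.refl)
  coeff-X^-other zero    (suc i) _   = refl
  coeff-X^-other (suc e) zero    _   = refl
  coeff-X^-other (suc e) (suc i) i≢e = coeff-X^-other e i (i≢e ∘ ≡.cong suc)

  length-X^ : ∀ e → length (X^ e) ≡ suc e
  length-X^ zero    = ≡.refl
  length-X^ (suc e) = ≡.cong suc (length-X^ e)

  -- Synthetic division by X - b: the quotient's coefficients are the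
  -- values at b of the proper tails of p.
  quotient : Poly → Carrier → Poly
  quotient []           b = []
  quotient (c ∷ [])     b = []
  quotient (c ∷ d ∷ ds) b = eval (d ∷ ds) b ∷ quotient (d ∷ ds) b

  length-quotient : ∀ c cs b → length (quotient (c ∷ cs) b) ≡ length cs
  length-quotient c []       b = ≡.refl
  length-quotient c (d ∷ ds) b = ≡.cong suc (length-quotient d ds b)

  division : ∀ p b x → eval p x ≈ (x - b) * eval (quotient p b) x + eval p b
  division []           b x = sym (trans (+-identityʳ _) (zeroʳ (x - b)))
  division (c ∷ [])     b x = begin
    c + x * 0#                    ≈⟨ trans (+-congˡ (zeroʳ x)) (+-identityʳ c) ⟩
    c                             ≈⟨ +-identityˡ c ⟨
    0# + c                        ≈⟨ +-cong (zeroʳ (x - b)) (trans (+-congˡ (zeroʳ b)) (+-identityʳ c)) ⟨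
    (x - b) * 0# + (c + b * 0#)   ∎
  division (c ∷ d ∷ ds) b x = begin
    c + x * eval (d ∷ ds) x                     ≈⟨ +-congˡ (*-congˡ (division (d ∷ ds) b x)) ⟩
    c + x * ((x - b) * G + E)                   ≈⟨ +-identityʳ _ ⟨
    c + x * ((x - b) * G + E) + 0#              ≈⟨ +-congˡ (trans (*-congʳ (-‿inverseʳ b)) (zeroˡ E)) ⟨
    c + x * ((x - b) * G + E) + (b - b) * E     ≈⟨ solve 6 (λ c x b b′ G E →
                                                       c :+ x :* ((x :+ b′) :* G :+ E) :+ (b :+ b′) :* E
                                                    := (x :+ b′) :* (E :+ x :* G) :+ (c :+ b :* E))
                                                     refl c x b (- b) G E ⟩
    (x - b) * (E + x * G) + (c + b * E)         ∎
    where
    G = eval (quotient (d ∷ ds) b) x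
    E = eval (d ∷ ds) b

  module RootBound (no-zero-divisors : ∀ {x y} → ¬ x ≈ 0# → x * y ≈ 0# → y ≈ 0#) where

    Distinct : List Carrier → Set (r ⊔ ℓ)
    Distinct = AllPairs (λ u v → ¬ u ≈ v)

    quotient-root : ∀ p {b r} → eval p b ≈ 0# → eval p r ≈ 0# → ¬ r ≈ b →
                    eval (quotient p b) r ≈ 0#
    quotient-root p {b} {r} pb≈0 pr≈0 r≉b = no-zero-divisors (r≉b ∘ x∙y⁻¹≈ε⇒x≈y r b) (begin
      (r - b) * eval (quotient p b) r             ≈⟨ +-identityʳ _ ⟨
      (r - b) * eval (quotient p b) r + 0#        ≈⟨ +-congˡ pb≈0 ⟨
      (r - b) * eval (quotient p b) r + eval p b  ≈⟨ division p b r ⟨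
      eval p r                                    ≈⟨ pr≈0 ⟩
      0#                                          ∎)

    quotient-zero : ∀ p b → eval p b ≈ 0# → AllZero (quotient p b) → AllZero p
    quotient-zero []           b _    _ = []
    quotient-zero (c ∷ [])     b pb≈0 _ =
      trans (sym (trans (+-congˡ (zeroʳ b)) (+-identityʳ c))) pb≈0 ∷ []
    quotient-zero (c ∷ d ∷ ds) b pb≈0 (tail≈0 ∷ rest≈0) = c≈0 ∷ quotient-zero (d ∷ ds) b tail≈0 rest≈0
      where
      c≈0 : c ≈ 0#
      c≈0 = begin
        c                          ≈⟨ +-identityʳ c ⟨
        c + 0#                     ≈⟨ +-congˡ (trans (*-congˡ tail≈0) (zeroʳ b)) ⟨
        c + b * eval (d ∷ ds) b    ≈⟨ pb≈0 ⟩
        0#                         ∎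

    root-bound : ∀ roots → Distinct roots → ∀ p → length p ≤ length roots →
                 All (λ r → eval p r ≈ 0#) roots → AllZero p
    root-bound _        _                  []       _         _ = []
    root-bound []       _                  (c ∷ cs) ()        _
    root-bound (b ∷ bs) (b≉bs ∷ distinct) (c ∷ cs) (s≤s len) (pb≈0 ∷ pbs≈0) =
      quotient-zero (c ∷ cs) b pb≈0
        (root-bound bs distinct (quotient (c ∷ cs) b)
          (≡.subst (_≤ length bs) (≡.sym (length-quotient c cs b)) len)
          (All.zipWith (λ (b≉r , pr≈0) → quotient-root (c ∷ cs) pb≈0 pr≈0 (b≉r ∘ sym))
                       (b≉bs , pbs≈0)))

module FiniteField {m : ℕ} (F : GF m) where
  open GF F hiding (zero)
  open import Algebra.Properties.CommutativeSemiring.Exp commutativeSemiring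
    using (_^_; ^-homo-*; ^-assocʳ; ^-distrib-*)
  open import Relation.Binary.Reasoning.Setoid setoid
  open Polynomials commRing
  module Card = Bijection card

  q : ℕ
  q = 2 ℕ.^ m

  element : Fin q → Carrier
  element i = Product.proj₁ (Card.strictlySurjective i)

  index-element : ∀ i → Card.to (element i) ≡ i
  index-element i = Product.proj₂ (Card.strictlySurjective i)

  element-index : ∀ x → element (Card.to x) ≈ x
  element-index x = Card.injective (index-element (Card.to x))

  element-injective : ∀ {i j} → element i ≈ element j → i ≡ j
  element-injective {i} {j} e =
    ≡.trans (≡.sym (index-element i)) (≡.trans (Card.cong e) (index-element j))

  infix 4 _≟_
  _≟_ : (x y : Carrier) → Dec (x ≈ y)
  x ≟ y with Card.to x FinP.≟ Card.to y
  ... | yes e = yes (Card.injective e)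
  ... | no ne = no (ne ∘ Card.cong)

  -- GF's `pow` is the library's exponentiation, which gives its laws
  pow≡^ : ∀ x n → pow x n ≡ x ^ n
  pow≡^ x zero    = ≡.refl
  pow≡^ x (suc n) = ≡.cong (x *_) (pow≡^ x n)

  pow-cong : ∀ n {x y} → x ≈ y → pow x n ≈ pow y n
  pow-cong zero    _   = refl
  pow-cong (suc n) x≈y = *-cong x≈y (pow-cong n x≈y)

  pow-+ : ∀ x a b → pow x (a ℕ.+ b) ≈ pow x a * pow x b
  pow-+ x a b rewrite pow≡^ x (a ℕ.+ b) | pow≡^ x a | pow≡^ x b = ^-homo-* x a b

  pow-* : ∀ x a b → pow (pow x a) b ≈ pow x (a ℕ.* b)
  pow-* x a b rewrite pow≡^ x a | pow≡^ (x ^ a) b | pow≡^ x (a ℕ.* b) = ^-assocʳ x a b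

  pow-distrib : ∀ x y n → pow (x * y) n ≈ pow x n * pow y n
  pow-distrib x y n rewrite pow≡^ (x * y) n | pow≡^ x n | pow≡^ y n = ^-distrib-* x y n

  pow-one : ∀ n → pow 1# n ≈ 1#
  pow-one zero    = refl
  pow-one (suc n) = trans (*-identityˡ _) (pow-one n)

  pow-zero : ∀ {n} → 0 < n → pow 0# n ≈ 0#
  pow-zero {suc n} _ = zeroˡ _

  pow-two : ∀ x → pow x 2 ≈ x * x
  pow-two x = *-congˡ (*-identityʳ x)

  *-cancelˡ-nonzero : ∀ {x y z} → ¬ x ≈ 0# → x * y ≈ x * z → y ≈ z
  *-cancelˡ-nonzero {x} {y} {z} x≉0 xy≈xz with inverse x x≉0
  ... | x⁻¹ , xx⁻¹≈1 = begin
    y               ≈⟨ *-identityˡ y ⟨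
    1# * y          ≈⟨ *-congʳ x⁻¹x≈1 ⟨
    (x⁻¹ * x) * y   ≈⟨ *-assoc _ _ _ ⟩
    x⁻¹ * (x * y)   ≈⟨ *-congˡ xy≈xz ⟩
    x⁻¹ * (x * z)   ≈⟨ *-assoc _ _ _ ⟨
    (x⁻¹ * x) * z   ≈⟨ *-congʳ x⁻¹x≈1 ⟩
    1# * z          ≈⟨ *-identityˡ z ⟩
    z               ∎
    where
    x⁻¹x≈1 : x⁻¹ * x ≈ 1#
    x⁻¹x≈1 = trans (*-comm x⁻¹ x) xx⁻¹≈1

  *-cancelʳ-nonzero : ∀ {x y z} → ¬ z ≈ 0# → x * z ≈ y * z → x ≈ y
  *-cancelʳ-nonzero z≉0 xz≈yz = *-cancelˡ-nonzero z≉0 (trans (*-comm _ _) (trans xz≈yz (*-comm _ _)))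

  no-zero-divisors : ∀ {x y} → ¬ x ≈ 0# → x * y ≈ 0# → y ≈ 0#
  no-zero-divisors x≉0 xy≈0 = *-cancelˡ-nonzero x≉0 (trans xy≈0 (sym (zeroʳ _)))

  open import Algebra.Properties.CommutativeMonoid.Sum *-commutativeMonoid using () renaming
    (sum to prod; sum-cong-≋ to prod-cong; sum-permute to prod-permute;
     ∑-distrib-+ to prod-distrib; sum-remove to prod-remove; sum-replicate to prod-replicate)

  prod-nonzero : ∀ {n} (h : Fin n → Carrier) → (∀ i → ¬ h i ≈ 0#) → ¬ prod h ≈ 0#
  prod-nonzero {zero}  h _    = 1≉0
  prod-nonzero {suc n} h h≉0 prod≈0 =
    prod-nonzero (h ∘ Fin.suc) (h≉0 ∘ Fin.suc) (no-zero-divisors (h≉0 Fin.zero) prod≈0)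

  prod-except : ∀ {n} (h : Fin n → Carrier) {a} i → h i ≈ 1# → (∀ j → j ≢ i → h j ≈ a) →
                prod h * a ≈ pow a n
  prod-except {suc n} h {a} i hi≈1 others = begin
    prod h * a                                       ≈⟨ *-congʳ (prod-remove {i = i} h) ⟩
    (h i * prod (h ∘ punchIn i)) * a                 ≈⟨ *-congʳ (*-cong hi≈1 (prod-cong
                                                          (λ j → others (punchIn i j) (FinP.punchInᵢ≢i i j)))) ⟩
    (1# * prod {n} (λ _ → a)) * a                    ≈⟨ *-congʳ (trans (*-identityˡ _) (prod-replicate n)) ⟩
    a ^ n * a                                        ≈⟨ *-comm _ _ ⟩
    a ^ suc n                                        ≡⟨ pow≡^ a (suc n) ⟨
    pow a (suc n)                                    ∎

  unitPart : Carrier → Carrier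
  unitPart x with x ≟ 0#
  ... | yes _ = 1#
  ... | no  _ = x

  unitPart-nonzero : ∀ x → ¬ unitPart x ≈ 0#
  unitPart-nonzero x with x ≟ 0#
  ... | yes _   = 1≉0
  ... | no  x≉0 = x≉0

  unitPart-cong : ∀ {x y} → x ≈ y → unitPart x ≈ unitPart y
  unitPart-cong {x} {y} x≈y with x ≟ 0# | y ≟ 0#
  ... | yes _   | yes _   = refl
  ... | yes x≈0 | no  y≉0 = ⊥-elim (y≉0 (trans (sym x≈y) x≈0))
  ... | no  x≉0 | yes y≈0 = ⊥-elim (x≉0 (trans x≈y y≈0))
  ... | no  _   | no  _   = x≈y

  scaleFactor : Carrier → Carrier → Carrier
  scaleFactor a x with x ≟ 0#
  ... | yes _ = 1#
  ... | no  _ = a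

  unitPart-scale : ∀ {a} → ¬ a ≈ 0# → ∀ x → unitPart (a * x) ≈ scaleFactor a x * unitPart x
  unitPart-scale {a} a≉0 x with a * x ≟ 0# | x ≟ 0#
  ... | yes _    | yes _   = sym (*-identityˡ 1#)
  ... | yes ax≈0 | no  x≉0 = ⊥-elim (x≉0 (no-zero-divisors a≉0 ax≈0))
  ... | no  ax≉0 | yes x≈0 = ⊥-elim (ax≉0 (trans (*-congˡ x≈0) (zeroʳ a)))
  ... | no  _    | no  _   = refl

  scaleFactor-zero : ∀ a {x} → x ≈ 0# → scaleFactor a x ≈ 1#
  scaleFactor-zero a {x} x≈0 with x ≟ 0#
  ... | yes _   = refl
  ... | no  x≉0 = ⊥-elim (x≉0 x≈0)

  scaleFactor-nonzero : ∀ a {x} → ¬ x ≈ 0# → scaleFactor a x ≈ a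
  scaleFactor-nonzero a {x} x≉0 with x ≟ 0#
  ... | yes x≈0 = ⊥-elim (x≉0 x≈0)
  ... | no  _   = refl

  scaling : ∀ a → ¬ a ≈ 0# → Permutation q q
  scaling a a≉0 with inverse a a≉0
  ... | a⁻¹ , aa⁻¹≈1 = permutation (multiplyBy a) (multiplyBy a⁻¹)
                                   (undo aa⁻¹≈1) (undo (trans (*-comm a⁻¹ a) aa⁻¹≈1))
    where
    multiplyBy : Carrier → Fin q → Fin q
    multiplyBy u i = Card.to (u * element i)

    undo : ∀ {u v} → u * v ≈ 1# → ∀ j → multiplyBy u (multiplyBy v j) ≡ j
    undo {u} {v} uv≈1 j = ≡.trans (Card.cong (begin
      u * element (Card.to (v * element j))  ≈⟨ *-congˡ (element-index _) ⟩
      u * (v * element j)                    ≈⟨ *-assoc u v _ ⟨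
      (u * v) * element j                    ≈⟨ *-congʳ uv≈1 ⟩
      1# * element j                         ≈⟨ *-identityˡ _ ⟩
      element j                              ∎)) (index-element j)

  prod-unitPart-scaled : ∀ a → ¬ a ≈ 0# →
    prod (λ i → unitPart (a * element i)) ≈ prod (unitPart ∘ element)
  prod-unitPart-scaled a a≉0 = begin
    prod (λ i → unitPart (a * element i))                   ≈⟨ prod-cong {q} (λ i → unitPart-cong (sym (element-index (a * element i)))) ⟩
    prod (λ i → unitPart (element (Card.to (a * element i)))) ≈⟨ prod-permute (unitPart ∘ element) (scaling a a≉0) ⟨
    prod (unitPart ∘ element)                               ∎

  -- Fermat: comparing the two products shows that the scale factors
  -- multiply to 1, while they multiply to a^(q-1)
  fermat : ∀ a → pow a q ≈ a
  fermat a with a ≟ 0#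
  ... | yes a≈0 = trans (pow-cong q a≈0) (trans (pow-zero (ℕP.m^n>0 2 m)) (sym a≈0))
  ... | no  a≉0 = begin
    pow a q          ≈⟨ prod-except S (Card.to 0#) S-at-zero S-elsewhere ⟨
    prod S * a       ≈⟨ *-congʳ prod-S≈1 ⟩
    1# * a           ≈⟨ *-identityˡ a ⟩
    a                ∎
    where
    S U : Fin q → Carrier
    S i = scaleFactor a (element i)
    U   = unitPart ∘ element

    prod-S≈1 : prod S ≈ 1#
    prod-S≈1 = *-cancelʳ-nonzero (prod-nonzero U (unitPart-nonzero ∘ element)) (begin
      prod S * prod U                           ≈⟨ prod-distrib S U ⟨
      prod (λ i → S i * U i)                    ≈⟨ prod-cong (λ i → unitPart-scale a≉0 (element i)) ⟨
      prod (λ i → unitPart (a * element i))     ≈⟨ prod-unitPart-scaled a a≉0 ⟩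
      prod U                                    ≈⟨ *-identityˡ _ ⟨
      1# * prod U                               ∎)

    S-at-zero : S (Card.to 0#) ≈ 1#
    S-at-zero = scaleFactor-zero a (element-index 0#)

    S-elsewhere : ∀ j → j ≢ Card.to 0# → S j ≈ a
    S-elsewhere j j≢0 = scaleFactor-nonzero a
      (λ ej≈0 → j≢0 (≡.trans (≡.sym (index-element j)) (Card.cong ej≈0)))

  eval-X^-pow : ∀ e x → eval (X^ e) x ≈ pow x e
  eval-X^-pow e x = trans (eval-X^ e x) (reflexive (≡.sym (pow≡^ x e)))

  open RootBound no-zero-divisors

  elements : List Carrier
  elements = tabulate element

  elements-distinct : Distinct elements
  elements-distinct = AllPairsP.tabulate⁺ (λ i≢j → i≢j ∘ element-injective)

  non-root : ∀ p → length p ≤ q → ∀ i → ¬ coeff p i ≈ 0# → ∃ λ y → ¬ eval p y ≈ 0#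
  non-root p len i pᵢ≉0 =
    Product.map element id (FinP.¬∀⟶∃¬ q _ (λ j → eval p (element j) ≟ 0#) not-all-roots)
    where
    not-all-roots : ¬ (∀ j → eval p (element j) ≈ 0#)
    not-all-roots all-roots = pᵢ≉0 (coeff-AllZero p i
      (root-bound elements elements-distinct p
        (≡.subst (length p ≤_) (≡.sym (ListP.length-tabulate element)) len)
        (AllP.tabulate⁺ all-roots)))

module CharacteristicTwo {k : ℕ} (F : GF (suc k)) where
  open GF F hiding (zero)
  open FiniteField F
  open import Algebra.Properties.Ring ring using (-1*x≈-x; -‿involutive; +-cancelʳ)
  open import Relation.Binary.Reasoning.Setoid setoid
  open import Algebra.Solver.Ring.NaturalCoefficients.Default commutativeSemiring
    using (solve; _:=_; _:+_; _:*_)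

  -- -1 = (-1)^q = ((-1)²)^(q/2) = 1
  1+1≈0 : 1# + 1# ≈ 0#
  1+1≈0 = begin
    1# + 1#    ≈⟨ +-congˡ minus-one≈one ⟨
    1# - 1#    ≈⟨ -‿inverseʳ 1# ⟩
    0#         ∎
    where
    minus-one≈one : - 1# ≈ 1#
    minus-one≈one = begin
      - 1#                            ≈⟨ fermat (- 1#) ⟨
      pow (- 1#) (2 ℕ.* 2 ℕ.^ k)      ≈⟨ pow-* (- 1#) 2 (2 ℕ.^ k) ⟨
      pow (pow (- 1#) 2) (2 ℕ.^ k)    ≈⟨ pow-cong (2 ℕ.^ k) (trans (pow-two (- 1#))
                                           (trans (-1*x≈-x (- 1#)) (-‿involutive 1#))) ⟩
      pow 1# (2 ℕ.^ k)                ≈⟨ pow-one (2 ℕ.^ k) ⟩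
      1#                              ∎

  x+x≈0 : ∀ x → x + x ≈ 0#
  x+x≈0 x = begin
    x + x             ≈⟨ +-cong (*-identityʳ x) (*-identityʳ x) ⟨
    x * 1# + x * 1#   ≈⟨ distribˡ x 1# 1# ⟨
    x * (1# + 1#)     ≈⟨ *-congˡ 1+1≈0 ⟩
    x * 0#            ≈⟨ zeroʳ x ⟩
    0#                ∎

  x+y≈0⇒x≈y : ∀ {x y} → x + y ≈ 0# → x ≈ y
  x+y≈0⇒x≈y {x} {y} x+y≈0 = +-cancelʳ y x y (trans x+y≈0 (sym (x+x≈0 y)))

  square-+ : ∀ x y → (x + y) * (x + y) ≈ x * x + y * y
  square-+ x y = begin
    (x + y) * (x + y)                   ≈⟨ solve 2 (λ x y → (x :+ y) :* (x :+ y)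
                                                := (x :* x :+ y :* y) :+ (x :* y :+ x :* y)) refl x y ⟩
    (x * x + y * y) + (x * y + x * y)   ≈⟨ +-congˡ (x+x≈0 (x * y)) ⟩
    (x * x + y * y) + 0#                ≈⟨ +-identityʳ _ ⟩
    x * x + y * y                       ∎

  pow-2^suc : ∀ j x → pow x (2 ℕ.^ suc j) ≈ pow (x * x) (2 ℕ.^ j)
  pow-2^suc j x = trans (sym (pow-* x 2 (2 ℕ.^ j))) (pow-cong (2 ℕ.^ j) (pow-two x))

  frobenius : ∀ j x y → pow (x + y) (2 ℕ.^ j) ≈ pow x (2 ℕ.^ j) + pow y (2 ℕ.^ j)
  frobenius zero    x y = trans (*-identityʳ _) (sym (+-cong (*-identityʳ x) (*-identityʳ y)))
  frobenius (suc j) x y = begin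
    pow (x + y) (2 ℕ.^ suc j)                    ≈⟨ pow-2^suc j (x + y) ⟩
    pow ((x + y) * (x + y)) (2 ℕ.^ j)            ≈⟨ pow-cong (2 ℕ.^ j) (square-+ x y) ⟩
    pow (x * x + y * y) (2 ℕ.^ j)                ≈⟨ frobenius j (x * x) (y * y) ⟩
    pow (x * x) (2 ℕ.^ j) + pow (y * y) (2 ℕ.^ j) ≈⟨ +-cong (pow-2^suc j x) (pow-2^suc j y) ⟨
    pow x (2 ℕ.^ suc j) + pow y (2 ℕ.^ suc j)    ∎

  trSum-cong : ∀ j {x y} → x ≈ y → trSum j x ≈ trSum j y
  trSum-cong zero    _   = refl
  trSum-cong (suc j) x≈y = +-cong (pow-cong (2 ℕ.^ j) x≈y) (trSum-cong j x≈y)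

  trSum-+ : ∀ j x y → trSum j (x + y) ≈ trSum j x + trSum j y
  trSum-+ zero    x y = sym (+-identityʳ 0#)
  trSum-+ (suc j) x y = begin
    pow (x + y) (2 ℕ.^ j) + trSum j (x + y)
      ≈⟨ +-cong (frobenius j x y) (trSum-+ j x y) ⟩
    (pow x (2 ℕ.^ j) + pow y (2 ℕ.^ j)) + (trSum j x + trSum j y)
      ≈⟨ solve 4 (λ a b c d → (a :+ b) :+ (c :+ d) := (a :+ c) :+ (b :+ d)) refl _ _ _ _ ⟩
    (pow x (2 ℕ.^ j) + trSum j x) + (pow y (2 ℕ.^ j) + trSum j y)
      ∎

  trSum-square : ∀ j x → trSum j x * trSum j x ≈ trSum j (x * x)
  trSum-square zero    x = zeroʳ 0#
  trSum-square (suc j) x = begin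
    (pow x (2 ℕ.^ j) + trSum j x) * (pow x (2 ℕ.^ j) + trSum j x)
      ≈⟨ square-+ _ _ ⟩
    pow x (2 ℕ.^ j) * pow x (2 ℕ.^ j) + trSum j x * trSum j x
      ≈⟨ +-cong (sym (pow-distrib x x (2 ℕ.^ j))) (trSum-square j x) ⟩
    pow (x * x) (2 ℕ.^ j) + trSum j (x * x)
      ∎

  -- the terms of trSum j (x²) are those of trSum j x shifted by one
  trSum-shift : ∀ j x → trSum j (x * x) + x ≈ pow x (2 ℕ.^ j) + trSum j x
  trSum-shift zero    x = trans (+-identityˡ x) (sym (trans (+-identityʳ _) (*-identityʳ x)))
  trSum-shift (suc j) x = begin
    (pow (x * x) (2 ℕ.^ j) + trSum j (x * x)) + x    ≈⟨ +-assoc _ _ _ ⟩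
    pow (x * x) (2 ℕ.^ j) + (trSum j (x * x) + x)    ≈⟨ +-cong (sym (pow-2^suc j x)) (trSum-shift j x) ⟩
    pow x (2 ℕ.^ suc j) + (pow x (2 ℕ.^ j) + trSum j x) ∎

  Tr-cong : ∀ {x y} → x ≈ y → Tr x ≈ Tr y
  Tr-cong = trSum-cong (suc k)

  Tr-+ : ∀ x y → Tr (x + y) ≈ Tr x + Tr y
  Tr-+ = trSum-+ (suc k)

  -- since x^q = x, the shift closes up
  Tr-square : ∀ x → Tr (x * x) ≈ Tr x
  Tr-square x = +-cancelʳ x (Tr (x * x)) (Tr x)
    (trans (trSum-shift (suc k) x) (trans (+-congʳ (fermat x)) (+-comm x (Tr x))))

  Tr-idempotent : ∀ x → Tr x * Tr x ≈ Tr x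
  Tr-idempotent x = trans (trSum-square (suc k) x) (Tr-square x)

  -- t² = t and t ≠ 0 force t = 1
  Tr-nonzero : ∀ x → ¬ Tr x ≈ 0# → Tr x ≈ 1#
  Tr-nonzero x Tr≉0 = x+y≈0⇒x≈y (no-zero-divisors Tr≉0 (begin
    Tr x * (Tr x + 1#)       ≈⟨ distribˡ (Tr x) (Tr x) 1# ⟩
    Tr x * Tr x + Tr x * 1#  ≈⟨ +-cong (Tr-idempotent x) (*-identityʳ (Tr x)) ⟩
    Tr x + Tr x              ≈⟨ x+x≈0 (Tr x) ⟩
    0#                       ∎))

  Tr-boolean : ∀ x → Tr x ≈ 0# ⊎ Tr x ≈ 1#
  Tr-boolean x with Tr x ≟ 0#
  ... | yes Tr≈0 = inj₁ Tr≈0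
  ... | no  Tr≉0 = inj₂ (Tr-nonzero x Tr≉0)

  -- Tr(1) is the parity of the degree k + 1
  trSum-one-even : ∀ j → trSum (j ℕ.+ j) 1# ≈ 0#
  trSum-one-even zero    = refl
  trSum-one-even (suc j) rewrite ℕP.+-suc j j = begin
    pow 1# (2 ℕ.^ suc (j ℕ.+ j)) + (pow 1# (2 ℕ.^ (j ℕ.+ j)) + trSum (j ℕ.+ j) 1#)
      ≈⟨ +-cong (pow-one (2 ℕ.^ suc (j ℕ.+ j))) (+-cong (pow-one (2 ℕ.^ (j ℕ.+ j))) (trSum-one-even j)) ⟩
    1# + (1# + 0#)    ≈⟨ +-congˡ (+-identityʳ 1#) ⟩
    1# + 1#           ≈⟨ 1+1≈0 ⟩
    0#                ∎

  Tr-one-odd : ∀ j → k ≡ j ℕ.+ j → Tr 1# ≈ 1#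
  Tr-one-odd j ≡.refl = trans (+-cong (pow-one (2 ℕ.^ (j ℕ.+ j))) (trSum-one-even j)) (+-identityʳ 1#)

module TraceOfCubes {k : ℕ} (F : GF (suc k)) where
  open GF F hiding (zero)
  open FiniteField F
  open CharacteristicTwo F
  open Polynomials commRing
  open import Relation.Binary.Reasoning.Setoid setoid
  open import Algebra.Solver.Ring.NaturalCoefficients.Default commutativeSemiring
    using (solve; _:=_; _:+_; _:*_; con)

  Q : Carrier → Carrier
  Q u = Tr (pow u 3)

  SumOfB : Carrier → Set
  SumOfB x = ∃ λ (us : List Carrier) → All (λ u → Q u ≈ 1#) us × sumL us ≈ x

  -- y ∈ B with x + y ∈ B; then x = y + (x + y) is a sum of elements of B
  Partner : Carrier → Set
  Partner x = ∃ λ y → Q y ≈ 1# × Q (x + y) ≈ 1#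

  partner⇒SumOfB : ∀ {x} → Partner x → SumOfB x
  partner⇒SumOfB {x} (y , Qy≈1 , Qx+y≈1) = (y ∷ (x + y) ∷ []) , (Qy≈1 ∷ Qx+y≈1 ∷ []) , (begin
    y + ((x + y) + 0#)   ≈⟨ +-congˡ (+-identityʳ _) ⟩
    y + (x + y)          ≈⟨ +-comm y (x + y) ⟩
    (x + y) + y          ≈⟨ +-assoc x y y ⟩
    x + (y + y)          ≈⟨ +-congˡ (x+x≈0 y) ⟩
    x + 0#               ≈⟨ +-identityʳ x ⟩
    x                    ∎)

  -- since Q only takes the values 0 and 1, partners for the zeros of Q suffice
  SumOfB-from-partners : (∀ x → Q x ≈ 0# → Partner x) → ∀ x → SumOfB x
  SumOfB-from-partners partner x with Tr-boolean (pow x 3)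
  ... | inj₁ Qx≈0 = partner⇒SumOfB (partner x Qx≈0)
  ... | inj₂ Qx≈1 = (x ∷ []) , (Qx≈1 ∷ []) , +-identityʳ x

  -- the polar form of Q; additive in its second argument
  cross : Carrier → Carrier → Carrier
  cross x y = Tr ((x * x) * y) + Tr (x * (y * y))

  pow-three : ∀ x → pow x 3 ≈ x * (x * x)
  pow-three x = *-congˡ (*-congˡ (*-identityʳ x))

  cube-+ : ∀ x y → pow (x + y) 3 ≈ (pow x 3 + pow y 3) + ((x * x) * y + x * (y * y))
  cube-+ x y = begin
    pow (x + y) 3                          ≈⟨ pow-three (x + y) ⟩
    (x + y) * ((x + y) * (x + y))          ≈⟨ solve 2 (λ x y → (x :+ y) :* ((x :+ y) :* (x :+ y))
                                                 := ((x :* (x :* x) :+ y :* (y :* y)) :+ ((x :* x) :* y :+ x :* (y :* y)))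
                                                    :+ (((x :* x) :* y :+ x :* (y :* y)) :+ ((x :* x) :* y :+ x :* (y :* y))))
                                                 refl x y ⟩
    ((x * (x * x) + y * (y * y)) + W) + (W + W) ≈⟨ +-cong (+-congʳ (+-cong (sym (pow-three x)) (sym (pow-three y)))) (x+x≈0 W) ⟩
    ((pow x 3 + pow y 3) + W) + 0#         ≈⟨ +-identityʳ _ ⟩
    (pow x 3 + pow y 3) + W                ∎
    where
    W = (x * x) * y + x * (y * y)

  Q-+ : ∀ x y → Q (x + y) ≈ (Q x + Q y) + cross x y
  Q-+ x y = begin
    Tr (pow (x + y) 3)                                        ≈⟨ Tr-cong (cube-+ x y) ⟩
    Tr ((pow x 3 + pow y 3) + ((x * x) * y + x * (y * y)))    ≈⟨ Tr-+ _ _ ⟩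
    Tr (pow x 3 + pow y 3) + Tr ((x * x) * y + x * (y * y))   ≈⟨ +-cong (Tr-+ _ _) (Tr-+ _ _) ⟩
    (Q x + Q y) + cross x y                                   ∎

  cross-cong : ∀ x {y z} → y ≈ z → cross x y ≈ cross x z
  cross-cong x y≈z = +-cong (Tr-cong (*-congˡ y≈z)) (Tr-cong (*-congˡ (*-cong y≈z y≈z)))

  cross-+ : ∀ x y z → cross x (y + z) ≈ cross x y + cross x z
  cross-+ x y z = begin
    Tr ((x * x) * (y + z)) + Tr (x * ((y + z) * (y + z)))
      ≈⟨ +-cong (Tr-cong (distribˡ (x * x) y z))
                (Tr-cong (trans (*-congˡ (square-+ y z)) (distribˡ x (y * y) (z * z)))) ⟩
    Tr ((x * x) * y + (x * x) * z) + Tr (x * (y * y) + x * (z * z))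
      ≈⟨ +-cong (Tr-+ _ _) (Tr-+ _ _) ⟩
    (Tr ((x * x) * y) + Tr ((x * x) * z)) + (Tr (x * (y * y)) + Tr (x * (z * z)))
      ≈⟨ solve 4 (λ a b c d → (a :+ b) :+ (c :+ d) := (a :+ c) :+ (b :+ d)) refl _ _ _ _ ⟩
    cross x y + cross x z
      ∎

  cross-zero : ∀ x → cross x 0# ≈ 0#
  cross-zero x = begin
    Tr ((x * x) * 0#) + Tr (x * (0# * 0#))  ≈⟨ +-cong (Tr-cong (zeroʳ _)) (Tr-cong (trans (*-congˡ (zeroʳ 0#)) (zeroʳ x))) ⟩
    Tr 0# + Tr 0#                           ≈⟨ x+x≈0 (Tr 0#) ⟩
    0#                                      ∎

  -- odd degree: 1 is a partner, since cross x 1 = Tr(x²) + Tr(x) = 0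
  partner-one : Tr 1# ≈ 1# → ∀ x → Q x ≈ 0# → Partner x
  partner-one Tr1≈1 x Qx≈0 = 1# , Q1≈1 , (begin
    Q (x + 1#)                  ≈⟨ Q-+ x 1# ⟩
    (Q x + Q 1#) + cross x 1#   ≈⟨ +-cong (+-cong Qx≈0 Q1≈1) cross-x-1≈0 ⟩
    (0# + 1#) + 0#              ≈⟨ trans (+-identityʳ _) (+-identityˡ 1#) ⟩
    1#                          ∎)
    where
    Q1≈1 : Q 1# ≈ 1#
    Q1≈1 = trans (Tr-cong (pow-one 3)) Tr1≈1

    cross-x-1≈0 : cross x 1# ≈ 0#
    cross-x-1≈0 = begin
      Tr ((x * x) * 1#) + Tr (x * (1# * 1#))
        ≈⟨ +-cong (Tr-cong (*-identityʳ _)) (Tr-cong (trans (*-congˡ (*-identityʳ 1#)) (*-identityʳ x))) ⟩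
      Tr (x * x) + Tr x    ≈⟨ +-congʳ (Tr-square x) ⟩
      Tr x + Tr x          ≈⟨ x+x≈0 (Tr x) ⟩
      0#                   ∎

  -- if Q x = 0 and y₁, y₂, y₃ ∈ B sum to 0, the values Q(x + yᵢ) sum to 1,
  -- because the cross terms add up to cross x 0 = 0
  triple-values-sum : ∀ {x y₁ y₂ y₃} → Q x ≈ 0# → Q y₁ ≈ 1# → Q y₂ ≈ 1# → Q y₃ ≈ 1# →
                      y₁ + (y₂ + y₃) ≈ 0# → Q (x + y₁) + (Q (x + y₂) + Q (x + y₃)) ≈ 1#
  triple-values-sum {x} {y₁} {y₂} {y₃} Qx≈0 Q₁ Q₂ Q₃ sum≈0 = begin
    Q (x + y₁) + (Q (x + y₂) + Q (x + y₃))
      ≈⟨ +-cong (shifted Q₁) (+-cong (shifted Q₂) (shifted Q₃)) ⟩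
    (1# + cross x y₁) + ((1# + cross x y₂) + (1# + cross x y₃))
      ≈⟨ solve 4 (λ o a b c → (o :+ a) :+ ((o :+ b) :+ (o :+ c)) := (o :+ (o :+ o)) :+ (a :+ (b :+ c)))
           refl 1# (cross x y₁) (cross x y₂) (cross x y₃) ⟩
    (1# + (1# + 1#)) + (cross x y₁ + (cross x y₂ + cross x y₃))
      ≈⟨ +-cong (trans (+-congˡ 1+1≈0) (+-identityʳ 1#)) cross-sum≈0 ⟩
    1# + 0#
      ≈⟨ +-identityʳ 1# ⟩
    1#
      ∎
    where
    shifted : ∀ {y} → Q y ≈ 1# → Q (x + y) ≈ 1# + cross x y
    shifted {y} Qy≈1 = trans (Q-+ x y) (+-congʳ (trans (+-cong Qx≈0 Qy≈1) (+-identityˡ 1#)))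

    cross-sum≈0 : cross x y₁ + (cross x y₂ + cross x y₃) ≈ 0#
    cross-sum≈0 = begin
      cross x y₁ + (cross x y₂ + cross x y₃)   ≈⟨ +-congˡ (cross-+ x y₂ y₃) ⟨
      cross x y₁ + cross x (y₂ + y₃)           ≈⟨ cross-+ x y₁ (y₂ + y₃) ⟨
      cross x (y₁ + (y₂ + y₃))                 ≈⟨ cross-cong x sum≈0 ⟩
      cross x 0#                               ≈⟨ cross-zero x ⟩
      0#                                       ∎

  partner-from-triple : ∀ {y₁ y₂ y₃} → Q y₁ ≈ 1# → Q y₂ ≈ 1# → Q y₃ ≈ 1# →
                        y₁ + (y₂ + y₃) ≈ 0# → ∀ x → Q x ≈ 0# → Partner x
  partner-from-triple {y₁} {y₂} {y₃} Q₁ Q₂ Q₃ sum≈0 x Qx≈0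
    with Tr-boolean (pow (x + y₁) 3) | Tr-boolean (pow (x + y₂) 3) | Tr-boolean (pow (x + y₃) 3)
  ... | inj₂ e  | _       | _       = y₁ , Q₁ , e
  ... | inj₁ _  | inj₂ e  | _       = y₂ , Q₂ , e
  ... | inj₁ _  | inj₁ _  | inj₂ e  = y₃ , Q₃ , e
  ... | inj₁ e₁ | inj₁ e₂ | inj₁ e₃ = ⊥-elim (1≉0 (begin
    1#                                        ≈⟨ triple-values-sum Qx≈0 Q₁ Q₂ Q₃ sum≈0 ⟨
    Q (x + y₁) + (Q (x + y₂) + Q (x + y₃))    ≈⟨ +-cong e₁ (+-cong e₂ e₃) ⟩
    0# + (0# + 0#)                            ≈⟨ trans (+-identityˡ _) (+-identityʳ 0#) ⟩
    0#                                        ∎))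

  Q-scale : ∀ {c} y → pow c 3 ≈ 1# → Q (c * y) ≈ Q y
  Q-scale {c} y c³≈1 = Tr-cong (trans (pow-distrib c y 3) (trans (*-congʳ c³≈1) (*-identityˡ _)))

  -- even degree: y₀, ωy₀, ω²y₀ ∈ B sum to (ω² + ω + 1)y₀ = 0
  partner-cube-root : ∀ {ω y₀} → ω * ω + ω + 1# ≈ 0# → pow ω 3 ≈ 1# → Q y₀ ≈ 1# →
                      ∀ x → Q x ≈ 0# → Partner x
  partner-cube-root {ω} {y₀} ω-quadratic ω³≈1 Qy₀≈1 =
    partner-from-triple Qy₀≈1 (trans (Q-scale y₀ ω³≈1) Qy₀≈1) (trans (Q-scale y₀ ω²³≈1) Qy₀≈1)
                        rotations-sum
    where
    ω²³≈1 : pow (ω * ω) 3 ≈ 1#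
    ω²³≈1 = trans (pow-distrib ω ω 3) (trans (*-cong ω³≈1 ω³≈1) (*-identityˡ 1#))

    rotations-sum : y₀ + (ω * y₀ + (ω * ω) * y₀) ≈ 0#
    rotations-sum = begin
      y₀ + (ω * y₀ + (ω * ω) * y₀)        ≈⟨ +-congʳ (*-identityˡ y₀) ⟨
      1# * y₀ + (ω * y₀ + (ω * ω) * y₀)   ≈⟨ solve 3 (λ o w y → o :* y :+ (w :* y :+ (w :* w) :* y)
                                                 := (w :* w :+ w :+ o) :* y) refl 1# ω y₀ ⟩
      (ω * ω + ω + 1#) * y₀               ≈⟨ *-congʳ ω-quadratic ⟩
      0# * y₀                             ≈⟨ zeroˡ y₀ ⟩
      0#                                  ∎

  -- ω ≠ 1 with ω³ = 1 satisfies ω² + ω + 1 = 0, as (ω + 1)(ω² + ω + 1) = ω³ + 1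
  cube-root-quadratic : ∀ {ω} → ¬ ω ≈ 1# → pow ω 3 ≈ 1# → ω * ω + ω + 1# ≈ 0#
  cube-root-quadratic {ω} ω≉1 ω³≈1 = no-zero-divisors (ω≉1 ∘ x+y≈0⇒x≈y) (begin
    (ω + 1#) * (ω * ω + ω + 1#)                      ≈⟨ solve 1 (λ w → (w :+ con 1) :* (w :* w :+ w :+ con 1)
                                                            := (w :* (w :* (w :* con 1)) :+ con 1) :+ ((w :* w :+ w) :+ (w :* w :+ w)))
                                                          refl ω ⟩
    (pow ω 3 + 1#) + ((ω * ω + ω) + (ω * ω + ω))     ≈⟨ +-cong (+-congʳ ω³≈1) (x+x≈0 _) ⟩
    (1# + 1#) + 0#                                   ≈⟨ +-identityʳ _ ⟩
    1# + 1#                                          ≈⟨ 1+1≈0 ⟩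
    0#                                               ∎)

  -- When q = 1 + 3D with D ≥ 1, F has a cube root of unity ω ≠ 1: take
  -- ω = g^D for a non-root g of X^(D+1) + X, which has fewer than q
  -- coefficients.
  module CubeRoot (d : ℕ) (q≡1+3D : q ≡ suc (3 ℕ.* suc d)) where
    D : ℕ
    D = suc d

    P : Poly
    P = X^ (suc D) ⊕ X^ 1

    eval-P : ∀ g → eval P g ≈ g * pow g D + g * 1#
    eval-P g = trans (eval-⊕ (X^ (suc D)) (X^ 1) g) (+-cong (eval-X^-pow (suc D) g) (eval-X^-pow 1 g))

    length-P : length P ≤ q
    length-P = ≡.subst (length P ≤_) (≡.sym q≡1+3D)
      (length-⊕ (X^ (suc D)) (X^ 1)
        (≡.subst (_≤ suc (3 ℕ.* D)) (≡.sym (length-X^ (suc D)))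
          (s≤s (ℕP.≤-trans (s≤s (ℕP.m≤n+m D d)) (ℕP.+-monoʳ-≤ D (ℕP.m≤m+n D (D ℕ.+ 0))))))
        (s≤s (s≤s z≤n)))

    coeff-P : ¬ coeff P (suc D) ≈ 0#
    coeff-P coeff≈0 = 1≉0 (begin
      1#                                            ≈⟨ +-identityʳ 1# ⟨
      1# + 0#                                       ≈⟨ +-cong (coeff-X^-same (suc D)) (coeff-X^-other 1 (suc D) (λ ())) ⟨
      coeff (X^ (suc D)) (suc D) + coeff (X^ 1) (suc D) ≈⟨ coeff-⊕ (X^ (suc D)) (X^ 1) (suc D) ⟨
      coeff P (suc D)                               ≈⟨ coeff≈0 ⟩
      0#                                            ∎)

    cube-root-from-non-root : ∀ g → ¬ eval P g ≈ 0# → ¬ pow g D ≈ 1# × pow (pow g D) 3 ≈ 1#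
    cube-root-from-non-root g Pg≉0 = ω≉1 , ω³≈1
      where
      g≉0 : ¬ g ≈ 0#
      g≉0 g≈0 = Pg≉0 (trans (eval-P g)
        (trans (+-cong (trans (*-congʳ g≈0) (zeroˡ _)) (trans (*-congʳ g≈0) (zeroˡ _))) (+-identityʳ 0#)))

      ω≉1 : ¬ pow g D ≈ 1#
      ω≉1 ω≈1 = Pg≉0 (trans (eval-P g) (trans (+-congʳ (*-congˡ ω≈1)) (x+x≈0 (g * 1#))))

      ω³≈1 : pow (pow g D) 3 ≈ 1#
      ω³≈1 = *-cancelˡ-nonzero g≉0 (begin
        g * pow (pow g D) 3     ≈⟨ *-congˡ (pow-* g D 3) ⟩
        g * pow g (D ℕ.* 3)     ≡⟨ ≡.cong (λ n → g * pow g n) (ℕP.*-comm D 3) ⟩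
        pow g (suc (3 ℕ.* D))   ≡⟨ ≡.cong (pow g) q≡1+3D ⟨
        pow g q                 ≈⟨ fermat g ⟩
        g                       ≈⟨ *-identityʳ g ⟨
        g * 1#                  ∎)

    cube-root-of-unity : ∃ λ ω → (ω * ω + ω + 1# ≈ 0#) × pow ω 3 ≈ 1#
    cube-root-of-unity =
      let g , Pg≉0   = non-root P length-P (suc D) coeff-P
          ω≉1 , ω³≈1 = cube-root-from-non-root g Pg≉0
      in  pow g D , cube-root-quadratic ω≉1 ω³≈1 , ω³≈1

  -- For k ≥ 2, B is nonempty: on F, Q agrees with the polynomial
  -- Σ_{j<k} X^(3·2^j) + X^(2^k+1) (using y^(3·2^k) = y^(q+2^k) = y^(2^k+1)),
  -- which has at most q coefficients and coefficient 1 at X³.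
  module Nonempty (2≤k : 2 ≤ k) where
    cubeTraces : ℕ → Poly
    cubeTraces zero    = []
    cubeTraces (suc j) = X^ (3 ℕ.* 2 ℕ.^ j) ⊕ cubeTraces j

    P : Poly
    P = cubeTraces k ⊕ X^ (suc (2 ℕ.^ k))

    eval-cubeTraces : ∀ j y → eval (cubeTraces j) y ≈ trSum j (pow y 3)
    eval-cubeTraces zero    y = refl
    eval-cubeTraces (suc j) y = trans (eval-⊕ (X^ (3 ℕ.* 2 ℕ.^ j)) (cubeTraces j) y)
      (+-cong (trans (eval-X^-pow (3 ℕ.* 2 ℕ.^ j) y) (sym (pow-* y 3 (2 ℕ.^ j)))) (eval-cubeTraces j y))

    top-term : ∀ y → pow y (suc (2 ℕ.^ k)) ≈ pow (pow y 3) (2 ℕ.^ k)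
    top-term y = begin
      y * pow y (2 ℕ.^ k)               ≈⟨ *-congʳ (fermat y) ⟨
      pow y q * pow y (2 ℕ.^ k)         ≈⟨ pow-+ y q (2 ℕ.^ k) ⟨
      pow y (q ℕ.+ 2 ℕ.^ k)             ≡⟨ ≡.cong (pow y) (thrice (2 ℕ.^ k)) ⟩
      pow y (3 ℕ.* 2 ℕ.^ k)             ≈⟨ pow-* y 3 (2 ℕ.^ k) ⟨
      pow (pow y 3) (2 ℕ.^ k)           ∎
      where
      thrice : ∀ t → 2 ℕ.* t ℕ.+ t ≡ 3 ℕ.* t
      thrice = solve-∀

    eval-P : ∀ y → eval P y ≈ Q y
    eval-P y = begin
      eval P y                                               ≈⟨ eval-⊕ (cubeTraces k) (X^ (suc (2 ℕ.^ k))) y ⟩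
      eval (cubeTraces k) y + eval (X^ (suc (2 ℕ.^ k))) y    ≈⟨ +-cong (eval-cubeTraces k y)
                                                                  (trans (eval-X^-pow (suc (2 ℕ.^ k)) y) (top-term y)) ⟩
      trSum k (pow y 3) + pow (pow y 3) (2 ℕ.^ k)            ≈⟨ +-comm _ _ ⟩
      Q y                                                    ∎

    three<3·2^suc : ∀ j → 3 < 3 ℕ.* 2 ℕ.^ suc j
    three<3·2^suc j = ℕP.*-monoʳ-< 3 (ℕP.*-monoʳ-≤ 2 (ℕP.m^n>0 2 j))

    coeff-cubeTraces : ∀ j → 1 ≤ j → coeff (cubeTraces j) 3 ≈ 1#
    coeff-cubeTraces (suc zero)    _ = trans (coeff-⊕ (X^ 3) [] 3) (+-identityʳ 1#)
    coeff-cubeTraces (suc (suc j)) _ = begin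
      coeff (X^ (3 ℕ.* 2 ℕ.^ suc j) ⊕ cubeTraces (suc j)) 3          ≈⟨ coeff-⊕ (X^ (3 ℕ.* 2 ℕ.^ suc j)) _ 3 ⟩
      coeff (X^ (3 ℕ.* 2 ℕ.^ suc j)) 3 + coeff (cubeTraces (suc j)) 3 ≈⟨ +-cong (coeff-X^-other _ 3 (ℕP.<⇒≢ (three<3·2^suc j)))
                                                                              (coeff-cubeTraces (suc j) (s≤s z≤n)) ⟩
      0# + 1#                                                         ≈⟨ +-identityˡ 1# ⟩
      1#                                                              ∎

    coeff-P : ¬ coeff P 3 ≈ 0#
    coeff-P coeff≈0 = 1≉0 (begin
      1#                                                     ≈⟨ +-identityʳ 1# ⟨
      1# + 0#                                                ≈⟨ +-cong (coeff-cubeTraces k (ℕP.<⇒≤ 2≤k))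
                                                                  (coeff-X^-other _ 3 (ℕP.<⇒≢ (ℕP.m<n⇒m<1+n (ℕP.^-monoʳ-≤ 2 2≤k)))) ⟨
      coeff (cubeTraces k) 3 + coeff (X^ (suc (2 ℕ.^ k))) 3  ≈⟨ coeff-⊕ (cubeTraces k) _ 3 ⟨
      coeff P 3                                              ≈⟨ coeff≈0 ⟩
      0#                                                     ∎)

    length-cubeTraces : ∀ j → j ≤ k → length (cubeTraces j) ≤ q
    length-cubeTraces zero    _   = z≤n
    length-cubeTraces (suc j) j<k = length-⊕ (X^ (3 ℕ.* 2 ℕ.^ j)) (cubeTraces j)
      (≡.subst (_≤ q) (≡.sym (length-X^ _)) (monomial-fits j<k))
      (length-cubeTraces j (ℕP.<⇒≤ j<k))

    length-P : length P ≤ q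
    length-P = length-⊕ (cubeTraces k) (X^ (suc (2 ℕ.^ k))) (length-cubeTraces k ℕP.≤-refl)
      (≡.subst (_≤ q) (≡.sym (length-X^ _))
        (≡.subst (suc (suc (2 ℕ.^ k)) ≤_) (≡.cong (2 ℕ.^ k ℕ.+_) (≡.sym (ℕP.+-identityʳ (2 ℕ.^ k))))
          (ℕP.+-monoˡ-≤ (2 ℕ.^ k) (ℕP.^-monoʳ-≤ 2 (ℕP.<⇒≤ 2≤k)))))

    B-nonempty : ∃ λ y → Q y ≈ 1#
    B-nonempty = Product.map id (λ {y} Py≉0 → Tr-nonzero (pow y 3) (Py≉0 ∘ trans (eval-P y)))
                             (non-root P length-P 3 coeff-P)

lemma14 : (m : ℕ) → 3 ≤ m → (F : GF m) →
    let open GF F in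
    ∀ (x : Carrier) → ∃ λ (us : List Carrier) →
      All (λ u → Tr (pow u 3) ≈ 1#) us × sumL us ≈ x
lemma14 (suc k) (s≤s 2≤k) F = SumOfB-from-partners partner
  where
  open GF F using (_≈_; 0#)
  open CharacteristicTwo F using (Tr-one-odd)
  open TraceOfCubes F

  partner : ∀ x → Q x ≈ 0# → Partner x
  partner with even-or-odd k
  ... | inj₁ (j , k≡j+j)   = partner-one (Tr-one-odd j k≡j+j)
  ... | inj₂ (j , k≡1+j+j) =
    let d , 4ʲ⁺¹≡1+3D          = four-power j
        q≡1+3D                 = ≡.trans (≡.cong (λ n → 2 ℕ.^ suc n)
                                   (≡.trans k≡1+j+j (≡.sym (ℕP.+-suc j j)))) 4ʲ⁺¹≡1+3D
        ω , ω-quadratic , ω³≈1 = CubeRoot.cube-root-of-unity d q≡1+3D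
        y₀ , Qy₀≈1             = Nonempty.B-nonempty 2≤k
    in  partner-cube-root ω-quadratic ω³≈1 Qy₀≈1
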